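{- Let $n$ be a positive integer and let $\mathscr G=\langle V,E\rangle$ be a hypergraph with $E\subseteq [V]^{\le n}$. Then the anticlique algebra $\mathrm{BA}(\mathscr G)$ is $n$-free (indeed $n$-free over $V_+=\{v_+:v\in V\}$).
   Context: A hypergraph is a pair $\langle V,E\rangle$ with $E\subseteq\mathcal P(V)\smallsetminus[V]^{\le1}$ (hyperedges have at least two elements). A set $A\subseteq V$ is an anticlique if it includes no hyperedge; $A(\mathscr G)$ denotes the set of anticliques. For $v\in V$, $v_+=\{S\in A(\mathscr G): v\in S\}\in\mathcal P(A(\mathscr G))$, and $\mathrm{BA}(\mathscr G)$ is the subalgebra of $\mathcal P(A(\mathscr G))$ generated by $\{v_+:v\in V\}$. For Boolean algebras $A,B$ and $U\subseteq A$, $f:U\to B$ is $n$-preserving if for all $a_0,\dots,a_{n-1}\in U$, $\prod_{i<n}a_i=0$ implies $\prod_{i<n} f(a_i)=0$; $A$ is $n$-free over $X\subseteq A$ if every $n$-preserving function from $X$ into an arbitrary nontrivial Boolean algebra extends to a unique homomorphism on $A$; $A$ is $n$-free if it is $n$-free over some subset. -}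

module Defs where

open import Level using (Level; 0ℓ; Setω) renaming (suc to lsuc; _⊔_ to _⊔ˡ_)
open import Data.Bool using (Bool; true; false; _∨_; _∧_; not)
import Data.Bool.Properties as BP
open import Data.Nat using (ℕ; zero; suc; _≤_)
open import Data.Fin using (Fin)
import Data.Fin as F
open import Data.List using (List; length)
open import Data.List.Membership.Propositional using (_∈_)
open import Data.Product using (Σ; Σ-syntax; ∃; ∃-syntax; _×_; _,_; proj₁; proj₂)
open import Relation.Nullary using (¬_)
open import Relation.Binary.PropositionalEquality
  using (_≡_; refl; sym; trans; cong; cong₂)
open import Algebra.Lattice.Bundles using (BooleanAlgebra)

-- Hypergraphs.
-- A subset of V is represented by its characteristic function V → Bool
-- (classically these are all subsets of V).

Subset : Set → Set
Subset V = V → Bool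

_⊆_ : {V : Set} → Subset V → Subset V → Set
_⊆_ {V} X Y = ∀ (v : V) → X v ≡ true → Y v ≡ true

HasAtLeastTwo : {V : Set} → Subset V → Set
HasAtLeastTwo {V} X = Σ[ u ∈ V ] Σ[ w ∈ V ] (¬ (u ≡ w) × X u ≡ true × X w ≡ true)

HasAtMost : {V : Set} → ℕ → Subset V → Set
HasAtMost {V} n X = Σ[ xs ∈ List V ] (length xs ≤ n × (∀ (v : V) → X v ≡ true → v ∈ xs))

record Hypergraph : Set₁ where
  field
    V        : Set
    E        : Subset V → Set
    edge-≥2  : ∀ (e : Subset V) → E e → HasAtLeastTwo e

open Hypergraph public

EdgesAtMost : ℕ → Hypergraph → Set
EdgesAtMost n G = ∀ (e : Subset (V G)) → E G e → HasAtMost n e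

IsAnticlique : (G : Hypergraph) → Subset (V G) → Set
IsAnticlique G S = ∀ (e : Subset (V G)) → E G e → ¬ (e ⊆ S)

Anticlique : Hypergraph → Set
Anticlique G = Σ (Subset (V G)) (IsAnticlique G)

-- BA(G): the subalgebra of P(A(G)) generated by {v₊ : v ∈ V}.
-- P(A(G)) is represented by A(G) → Bool with pointwise operations.
-- The generated subalgebra is the set of values of Boolean terms in the
-- generators v₊; we take as carrier the terms themselves, with two terms
-- equal iff they denote the same element of P(A(G)).

data Term (X : Set) : Set where
  var      : X → Term X
  _∨ᵗ_ _∧ᵗ_ : Term X → Term X → Term X
  ¬ᵗ_      : Term X → Term X
  ⊤ᵗ ⊥ᵗ    : Term X

_₊ : {G : Hypergraph} → V G → Anticlique G → Bool
(v ₊) S = proj₁ S v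

eval : (G : Hypergraph) → Term (V G) → Anticlique G → Bool
eval G (var v) S = (_₊ {G} v) S
eval G (t ∨ᵗ s) S = eval G t S ∨ eval G s S
eval G (t ∧ᵗ s) S = eval G t S ∧ eval G s S
eval G (¬ᵗ t) S = not (eval G t S)
eval G ⊤ᵗ S = true
eval G ⊥ᵗ S = false

BA : Hypergraph → BooleanAlgebra 0ℓ 0ℓ
BA G = record
  { Carrier = Term (V G)
  ; _≈_ = _≈_
  ; _∨_ = _∨ᵗ_
  ; _∧_ = _∧ᵗ_
  ; ¬_ = ¬ᵗ_
  ; ⊤ = ⊤ᵗ
  ; ⊥ = ⊥ᵗ
  ; isBooleanAlgebra = record
    { isDistributiveLattice = record
      { isLattice = record
        { isEquivalence = record
          { refl = λ S → refl
          ; sym = λ p S → sym (p S)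
          ; trans = λ p q S → trans (p S) (q S) }
        ; ∨-comm = λ x y S → BP.∨-comm (⟦ x ⟧ S) (⟦ y ⟧ S)
        ; ∨-assoc = λ x y z S → BP.∨-assoc (⟦ x ⟧ S) (⟦ y ⟧ S) (⟦ z ⟧ S)
        ; ∨-cong = λ p q S → cong₂ _∨_ (p S) (q S)
        ; ∧-comm = λ x y S → BP.∧-comm (⟦ x ⟧ S) (⟦ y ⟧ S)
        ; ∧-assoc = λ x y z S → BP.∧-assoc (⟦ x ⟧ S) (⟦ y ⟧ S) (⟦ z ⟧ S)
        ; ∧-cong = λ p q S → cong₂ _∧_ (p S) (q S)
        ; absorptive = (λ x y S → BP.∨-abs-∧ (⟦ x ⟧ S) (⟦ y ⟧ S))
                     , (λ x y S → BP.∧-abs-∨ (⟦ x ⟧ S) (⟦ y ⟧ S))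
        }
      ; ∨-distrib-∧ = (λ x y z S → BP.∨-distribˡ-∧ (⟦ x ⟧ S) (⟦ y ⟧ S) (⟦ z ⟧ S))
                    , (λ x y z S → BP.∨-distribʳ-∧ (⟦ x ⟧ S) (⟦ y ⟧ S) (⟦ z ⟧ S))
      ; ∧-distrib-∨ = (λ x y z S → BP.∧-distribˡ-∨ (⟦ x ⟧ S) (⟦ y ⟧ S) (⟦ z ⟧ S))
                    , (λ x y z S → BP.∧-distribʳ-∨ (⟦ x ⟧ S) (⟦ y ⟧ S) (⟦ z ⟧ S))
      }
    ; ∨-complement = (λ x S → BP.∨-inverseˡ (⟦ x ⟧ S))
                   , (λ x S → BP.∨-inverseʳ (⟦ x ⟧ S))
    ; ∧-complement = (λ x S → BP.∧-inverseˡ (⟦ x ⟧ S))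
                   , (λ x S → BP.∧-inverseʳ (⟦ x ⟧ S))
    ; ¬-cong = λ p S → cong not (p S)
    }
  }
  where
  ⟦_⟧ : Term (V G) → Anticlique G → Bool
  ⟦_⟧ = eval G
  _≈_ : Term (V G) → Term (V G) → Set
  t ≈ s = ∀ (S : Anticlique G) → ⟦ t ⟧ S ≡ ⟦ s ⟧ S

V₊ : (G : Hypergraph) → BooleanAlgebra.Carrier (BA G) → Set
V₊ G t = Σ[ v ∈ V G ] BooleanAlgebra._≈_ (BA G) t (var v)

module _ {a ℓa : Level} (A : BooleanAlgebra a ℓa) where
  open BooleanAlgebra A using (Carrier; _≈_; ⊤; ⊥) renaming (_∧_ to _⊓_)

  Nontrivial : Set ℓa
  Nontrivial = ¬ (⊤ ≈ ⊥)

  ⋀ : (n : ℕ) → (Fin n → Carrier) → Carrier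
  ⋀ zero    x = ⊤
  ⋀ (suc n) x = x F.zero ⊓ ⋀ n (λ i → x (F.suc i))

module _ {a ℓa b ℓb : Level} (A : BooleanAlgebra a ℓa) (B : BooleanAlgebra b ℓb) where
  private
    module A = BooleanAlgebra A
    module B = BooleanAlgebra B

  record IsHomomorphism (h : A.Carrier → B.Carrier) : Set (a ⊔ˡ ℓa ⊔ˡ ℓb) where
    field
      cong-h : ∀ {x y} → x A.≈ y → h x B.≈ h y
      h-∨    : ∀ x y → h (x A.∨ y) B.≈ (h x B.∨ h y)
      h-∧    : ∀ x y → h (x A.∧ y) B.≈ (h x B.∧ h y)
      h-¬    : ∀ x → h (A.¬ x) B.≈ B.¬ (h x)
      h-⊤    : h A.⊤ B.≈ B.⊤
      h-⊥    : h A.⊥ B.≈ B.⊥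

  module _ {ℓu : Level} (U : A.Carrier → Set ℓu) where
    record FunctionOn : Set (a ⊔ˡ ℓa ⊔ˡ ℓu ⊔ˡ b ⊔ˡ ℓb) where
      field
        fun  : Σ A.Carrier U → B.Carrier
        wd   : ∀ (x y : Σ A.Carrier U) → proj₁ x A.≈ proj₁ y → fun x B.≈ fun y
    open FunctionOn public

    NPreserving : ℕ → FunctionOn → Set (a ⊔ˡ ℓa ⊔ˡ ℓu ⊔ˡ ℓb)
    NPreserving n f = ∀ (x : Fin n → Σ A.Carrier U) →
      ⋀ A n (λ i → proj₁ (x i)) A.≈ A.⊥ →
      ⋀ B n (λ i → fun f (x i)) B.≈ B.⊥

    Extends : FunctionOn → (A.Carrier → B.Carrier) → Set (a ⊔ˡ ℓu ⊔ˡ ℓb)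
    Extends f h = ∀ (x : Σ A.Carrier U) → h (proj₁ x) B.≈ fun f x

    ExtendsUniquely : FunctionOn → Set (a ⊔ˡ ℓa ⊔ˡ ℓu ⊔ˡ b ⊔ˡ ℓb)
    ExtendsUniquely f =
      Σ[ h ∈ (A.Carrier → B.Carrier) ] (IsHomomorphism h × Extends f h ×
        (∀ (h' : A.Carrier → B.Carrier) → IsHomomorphism h' → Extends f h' →
           ∀ (x : A.Carrier) → h' x B.≈ h x))

IsNFreeOver : {a ℓa ℓu : Level} → ℕ → (A : BooleanAlgebra a ℓa) →
              (BooleanAlgebra.Carrier A → Set ℓu) → Setω
IsNFreeOver n A U =
  ∀ {b ℓb : Level} (B : BooleanAlgebra b ℓb) → Nontrivial B →
  (f : FunctionOn A B U) → NPreserving A B U n f → ExtendsUniquely A B U f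

record IsNFree {a ℓa : Level} (n : ℕ) (A : BooleanAlgebra a ℓa) : Setω where
  field
    U    : BooleanAlgebra.Carrier A → Set a
    free : IsNFreeOver n A U

record _×ω_ (P Q : Setω) : Setω where
  constructor _,ω_
  field
    fst : P
    snd : Q

module Submission where

open import Defs
open import Level using (Level)
open import Data.Bool using (Bool; true; false; if_then_else_)
import Data.Bool as Bool
open import Data.Bool.Properties using (∨-∧-booleanAlgebra)
import Data.Bool.Properties as BoolProp
open import Data.Nat using (ℕ; _≤_; zero; suc; s≤s)
open import Data.Fin using (Fin)
import Data.Fin as F
open import Data.List using (List; []; _∷_; length; _++_; map)
open import Data.List.Membership.Propositional using (_∈_)
open import Data.List.Membership.Propositional.Properties using (∈-++⁺ˡ; ∈-++⁺ʳ; ∈-map⁻)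
open import Data.List.Relation.Unary.Any using (here; there)
open import Data.Product using (Σ; Σ-syntax; ∃-syntax; _×_; _,_; proj₁; proj₂)
open import Data.Sum using (_⊎_; inj₁; inj₂)
open import Data.Empty using (⊥-elim)
open import Relation.Nullary using (Dec; yes; no; does)
open import Relation.Binary.PropositionalEquality as ≡ using (_≡_; refl)
open import Algebra.Lattice.Bundles using (BooleanAlgebra)
import Algebra.Lattice.Properties.BooleanAlgebra as BooleanAlgebraProperties
import Relation.Binary.Lattice as OrderTheoretic

-- Read a term t over V in B by sending each variable v to g v = f(v₊); the
-- point is that the resulting ⟦t⟧ respects equality in BA(G).  Splitting
-- along every variable of t (Shannon expansion) writes ⟦t⟧ as a join of
-- atoms c ∧ ⟦t⟧, c a meet of literals g v and ¬ g v.  If the positive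
-- literals of c form an anticlique S, then c decides ⟦t⟧ exactly as S
-- decides t.  Otherwise c is inconsistent or lies below g v for every vertex
-- v of some hyperedge; a hyperedge has at most n vertices, so n-preservation
-- makes that meet, hence c, zero.  Thus ⟦t⟧ = ⊥ whenever t vanishes on every
-- anticlique.

padded : {A : Set} → List A → A → (n : ℕ) → Fin n → A
padded []       u n       i         = u
padded (w ∷ ws) u (suc n) F.zero    = w
padded (w ∷ ws) u (suc n) (F.suc i) = padded ws u n i

padded-surjective : {A : Set} {v : A} (ws : List A) (u : A) {n : ℕ} →
                    length ws ≤ n → v ∈ ws → ∃[ i ] padded ws u n i ≡ v
padded-surjective (w ∷ ws) u (s≤s _) (here refl) = F.zero , refl
padded-surjective (w ∷ ws) u (s≤s l) (there v∈ws) with padded-surjective ws u l v∈ws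
... | i , wsᵢ≡v = F.suc i , wsᵢ≡v

-- u pads the indices beyond the covering list.
hasAtMost⇒imageOfFin : {V : Set} {n : ℕ} (X : Subset V) {u : V} → X u ≡ true →
  HasAtMost n X →
  Σ[ x ∈ (Fin n → V) ] ((∀ i → X (x i) ≡ true) × (∀ v → X v ≡ true → ∃[ i ] x i ≡ v))
hasAtMost⇒imageOfFin {V} {n} X {u} Xu (ws , |ws|≤n , X⊆ws) = x , x∈X , onto
  where
  inX : V → V
  inX w = if X w then w else u

  x : Fin n → V
  x i = inX (padded ws u n i)

  x∈X : ∀ i → X (x i) ≡ true
  x∈X i with X (padded ws u n i) in Xw
  ... | true  = Xw
  ... | false = Xu

  inX-fixes : ∀ w → X w ≡ true → inX w ≡ w
  inX-fixes w Xw rewrite Xw = refl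

  onto : ∀ v → X v ≡ true → ∃[ i ] x i ≡ v
  onto v Xv with padded-surjective ws u |ws|≤n (X⊆ws v Xv)
  ... | i , refl = i , inX-fixes _ Xv

vars : {X : Set} → Term X → List X
vars (var x)  = x ∷ []
vars (t ∨ᵗ s) = vars t ++ vars s
vars (t ∧ᵗ s) = vars t ++ vars s
vars (¬ᵗ t)   = vars t
vars ⊤ᵗ       = []
vars ⊥ᵗ       = []

module _ {o ℓ : Level} (B : BooleanAlgebra o ℓ) where
  open BooleanAlgebra B

  interpret : {X : Set} → (X → Carrier) → Term X → Carrier
  interpret g (var x)  = g x
  interpret g (t ∨ᵗ s) = interpret g t ∨ interpret g s
  interpret g (t ∧ᵗ s) = interpret g t ∧ interpret g s
  interpret g (¬ᵗ t)   = ¬ interpret g t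
  interpret g ⊤ᵗ       = ⊤
  interpret g ⊥ᵗ       = ⊥

𝔹 : BooleanAlgebra _ _
𝔹 = ∨-∧-booleanAlgebra

eval≡interpret𝔹 : (G : Hypergraph) (t : Term (V G)) (S : Anticlique G) →
                  eval G t S ≡ interpret 𝔹 (proj₁ S) t
eval≡interpret𝔹 G (var v)  S = refl
eval≡interpret𝔹 G (t ∨ᵗ s) S = ≡.cong₂ Bool._∨_ (eval≡interpret𝔹 G t S) (eval≡interpret𝔹 G s S)
eval≡interpret𝔹 G (t ∧ᵗ s) S = ≡.cong₂ Bool._∧_ (eval≡interpret𝔹 G t S) (eval≡interpret𝔹 G s S)
eval≡interpret𝔹 G (¬ᵗ t)   S = ≡.cong Bool.not (eval≡interpret𝔹 G t S)
eval≡interpret𝔹 G ⊤ᵗ       S = refl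
eval≡interpret𝔹 G ⊥ᵗ       S = refl

module BooleanOrder {o ℓ : Level} (B : BooleanAlgebra o ℓ) where
  open BooleanAlgebra B
  open BooleanAlgebraProperties B
  open import Relation.Binary.Reasoning.Setoid setoid
  -- x ⊑ y is the natural order x ≈ x ∧ y.
  open OrderTheoretic.Lattice ∨-∧-orderTheoreticLattice public
    using (x≤x∨y; y≤x∨y; ∨-least; x∧y≤x; x∧y≤y; ∧-greatest; antisym; ≲-respˡ-≈; ≲-respʳ-≈)
    renaming (_≤_ to _⊑_; trans to ⊑-trans; refl to ⊑-refl; reflexive to ⊑-reflexive)

  ⊥⊑x : ∀ x → ⊥ ⊑ x
  ⊥⊑x x = sym (∧-zeroˡ x)

  x⊑⊤ : ∀ x → x ⊑ ⊤
  x⊑⊤ x = sym (∧-identityʳ x)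

  x⊑⊥⇒x≈⊥ : ∀ {x} → x ⊑ ⊥ → x ≈ ⊥
  x⊑⊥⇒x≈⊥ {x} x⊑⊥ = trans x⊑⊥ (∧-zeroʳ x)

  ⊑-contradiction : ∀ {c a} → c ⊑ a → c ⊑ ¬ a → c ≈ ⊥
  ⊑-contradiction {a = a} c⊑a c⊑¬a =
    x⊑⊥⇒x≈⊥ (≲-respʳ-≈ (∧-complementʳ a) (∧-greatest c⊑a c⊑¬a))

  ⊑-by-cases : ∀ {c x} a → c ∧ a ⊑ x → c ∧ ¬ a ⊑ x → c ⊑ x
  ⊑-by-cases {c} a c∧a⊑x c∧¬a⊑x = ⊑-trans c⊑split (∨-least c∧a⊑x c∧¬a⊑x)
    where
    c⊑split : c ⊑ (c ∧ a) ∨ (c ∧ ¬ a)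
    c⊑split = ⊑-reflexive (begin
      c                     ≈⟨ ∧-identityʳ c ⟨
      c ∧ ⊤                 ≈⟨ ∧-congˡ (∨-complementʳ a) ⟨
      c ∧ (a ∨ ¬ a)         ≈⟨ ∧-distribˡ-∨ c a (¬ a) ⟩
      (c ∧ a) ∨ (c ∧ ¬ a)   ∎)

  x∧¬y≈⊥⇒x⊑y : ∀ {x y} → x ∧ ¬ y ≈ ⊥ → x ⊑ y
  x∧¬y≈⊥⇒x⊑y {x} {y} x∧¬y≈⊥ =
    ⊑-by-cases y (x∧y≤y x y) (≲-respˡ-≈ (sym x∧¬y≈⊥) (⊥⊑x y))

  ⊑-⋀ : ∀ {c} m (x : Fin m → Carrier) → (∀ i → c ⊑ x i) → c ⊑ ⋀ B m x
  ⊑-⋀ zero    x c⊑x = x⊑⊤ _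
  ⊑-⋀ (suc m) x c⊑x = ∧-greatest (c⊑x F.zero) (⊑-⋀ m (λ i → x (F.suc i)) (λ i → c⊑x (F.suc i)))

module Literals {o ℓ : Level} (B : BooleanAlgebra o ℓ) {X : Set} (g : X → BooleanAlgebra.Carrier B) where
  open BooleanAlgebra B using (Carrier; _≈_; _∧_; ¬_; ⊥; sym)
  open BooleanAlgebraProperties B using (deMorgan₁; deMorgan₂; ¬-involutive; ¬⊥≈⊤)
  open BooleanOrder B

  literal : Bool → Carrier → Carrier
  literal true  x = x
  literal false x = ¬ x

  -- A list L of signed variables stands for the meet of the literals
  -- literal b (g v), (v , b) ∈ L, and for the partial assignment v ↦ b.
  infix 4 _⊑ᴸ_ _⊨_

  _⊑ᴸ_ : Carrier → List (X × Bool) → Set ℓ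
  c ⊑ᴸ L = ∀ {v b} → (v , b) ∈ L → c ⊑ literal b (g v)

  _⊨_ : (X → Bool) → List (X × Bool) → Set
  σ ⊨ L = ∀ {v b} → (v , b) ∈ L → σ v ≡ b

  ⊑-interpret : (σ : X → Bool) {c : Carrier} (t : Term X) →
                (∀ {v} → v ∈ vars t → c ⊑ literal (σ v) (g v)) →
                c ⊑ literal (interpret 𝔹 σ t) (interpret B g t)
  ⊑-interpret σ (var v) decided = decided (here refl)
  ⊑-interpret σ (t ∨ᵗ t′) decided
    with interpret 𝔹 σ t  | ⊑-interpret σ t (λ v∈t → decided (∈-++⁺ˡ v∈t))
       | interpret 𝔹 σ t′ | ⊑-interpret σ t′ (λ v∈t′ → decided (∈-++⁺ʳ (vars t) v∈t′))
  ... | true  | c⊑t  | _     | _     = ⊑-trans c⊑t (x≤x∨y _ _)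
  ... | false | _    | true  | c⊑t′  = ⊑-trans c⊑t′ (y≤x∨y _ _)
  ... | false | c⊑¬t | false | c⊑¬t′ = ≲-respʳ-≈ (sym (deMorgan₂ _ _)) (∧-greatest c⊑¬t c⊑¬t′)
  ⊑-interpret σ (t ∧ᵗ t′) decided
    with interpret 𝔹 σ t  | ⊑-interpret σ t (λ v∈t → decided (∈-++⁺ˡ v∈t))
       | interpret 𝔹 σ t′ | ⊑-interpret σ t′ (λ v∈t′ → decided (∈-++⁺ʳ (vars t) v∈t′))
  ... | false | c⊑¬t | _     | _     = ≲-respʳ-≈ (sym (deMorgan₁ _ _)) (⊑-trans c⊑¬t (x≤x∨y _ _))
  ... | true  | _    | false | c⊑¬t′ = ≲-respʳ-≈ (sym (deMorgan₁ _ _)) (⊑-trans c⊑¬t′ (y≤x∨y _ _))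
  ... | true  | c⊑t  | true  | c⊑t′  = ∧-greatest c⊑t c⊑t′
  ⊑-interpret σ (¬ᵗ t) decided with interpret 𝔹 σ t | ⊑-interpret σ t decided
  ... | true  | c⊑t  = ≲-respʳ-≈ (sym (¬-involutive _)) c⊑t
  ... | false | c⊑¬t = c⊑¬t
  ⊑-interpret σ ⊤ᵗ decided = x⊑⊤ _
  ⊑-interpret σ ⊥ᵗ decided = ≲-respʳ-≈ (sym ¬⊥≈⊤) (x⊑⊤ _)

  module _ (Valid : (X → Bool) → Set)
           (realise : ∀ L {c} → c ⊑ᴸ L → c ≈ ⊥ ⊎ Σ[ σ ∈ (X → Bool) ] (Valid σ × σ ⊨ L)) where

    ⊑¬interpret : (t : Term X) (ys : List X) (L : List (X × Bool)) {c : Carrier} → c ⊑ᴸ L →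
                  (∀ {v} → v ∈ vars t → v ∈ ys ⊎ v ∈ map proj₁ L) →
                  (∀ σ → Valid σ → σ ⊨ L → interpret 𝔹 σ t ≡ false) →
                  c ⊑ ¬ interpret B g t
    ⊑¬interpret t [] L {c} c⊑L covered vanishes with realise L c⊑L
    ... | inj₁ c≈⊥ = ≲-respˡ-≈ (sym c≈⊥) (⊥⊑x _)
    ... | inj₂ (σ , valid , σ⊨L) =
      ≡.subst (λ b → c ⊑ literal b (interpret B g t)) (vanishes σ valid σ⊨L)
              (⊑-interpret σ t decided)
      where
      decided : ∀ {v} → v ∈ vars t → c ⊑ literal (σ v) (g v)
      decided v∈t with covered v∈t
      ... | inj₂ v∈L with ∈-map⁻ proj₁ v∈L
      ...   | (v , b) , vb∈L , refl =
        ≡.subst (λ b → c ⊑ literal b (g v)) (≡.sym (σ⊨L vb∈L)) (c⊑L vb∈L)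
    ⊑¬interpret t (y ∷ ys) L {c} c⊑L covered vanishes =
      ⊑-by-cases (g y) (split true) (split false)
      where
      split : ∀ b → c ∧ literal b (g y) ⊑ ¬ interpret B g t
      split b = ⊑¬interpret t ys ((y , b) ∷ L) c∧y⊑ᴸ covered′
                  (λ σ valid σ⊨ → vanishes σ valid (λ p → σ⊨ (there p)))
        where
        c∧y⊑ᴸ : c ∧ literal b (g y) ⊑ᴸ ((y , b) ∷ L)
        c∧y⊑ᴸ (here refl) = x∧y≤y _ _
        c∧y⊑ᴸ (there p)   = ⊑-trans (x∧y≤x _ _) (c⊑L p)

        covered′ : ∀ {v} → v ∈ vars t → v ∈ ys ⊎ v ∈ map proj₁ ((y , b) ∷ L)
        covered′ v∈t with covered v∈t
        ... | inj₁ (here refl)   = inj₂ (here refl)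
        ... | inj₁ (there v∈ys)  = inj₁ v∈ys
        ... | inj₂ v∈L           = inj₂ (there v∈L)

    -- Starting the splitting from c = ⟦t⟧ itself gives ⟦t⟧ ⊑ ¬ ⟦t⟧.
    interpret-⊥ : (t : Term X) → (∀ σ → Valid σ → interpret 𝔹 σ t ≡ false) → interpret B g t ≈ ⊥
    interpret-⊥ t vanishes =
      ⊑-contradiction ⊑-refl (⊑¬interpret t (vars t) [] (λ ()) inj₁ (λ σ valid _ → vanishes σ valid))

    interpret-cong : (t t′ : Term X) → (∀ σ → Valid σ → interpret 𝔹 σ t ≡ interpret 𝔹 σ t′) →
                     interpret B g t ≈ interpret B g t′
    interpret-cong t t′ agree =
      antisym (interpret-⊑ t t′ agree) (interpret-⊑ t′ t (λ σ valid → ≡.sym (agree σ valid)))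
      where
      interpret-⊑ : (t t′ : Term X) → (∀ σ → Valid σ → interpret 𝔹 σ t ≡ interpret 𝔹 σ t′) →
                    interpret B g t ⊑ interpret B g t′
      interpret-⊑ t t′ agree = x∧¬y≈⊥⇒x⊑y (interpret-⊥ (t ∧ᵗ (¬ᵗ t′)) λ σ valid →
        ≡.trans (≡.cong (λ b → b Bool.∧ Bool.not (interpret 𝔹 σ t′)) (agree σ valid))
                (BoolProp.∧-inverseʳ (interpret 𝔹 σ t′)))

module _ (G : Hypergraph) where
  open BooleanAlgebra (BA G) using () renaming (_≈_ to _≈ᴳ_)

  eval-⋀-true : ∀ m (y : Fin m → Term (V G)) (S : Anticlique G) →
                eval G (⋀ (BA G) m y) S ≡ true → ∀ i → eval G (y i) S ≡ true
  eval-⋀-true (suc m) y S all-true i with eval G (y F.zero) S in y₀-true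
  eval-⋀-true (suc m) y S all-true F.zero    | true = y₀-true
  eval-⋀-true (suc m) y S all-true (F.suc i) | true = eval-⋀-true m (λ j → y (F.suc j)) S all-true i

  hyperedge-meet-vanishes : ∀ {n} → EdgesAtMost n G → ∀ e → E G e →
    Σ[ x ∈ (Fin n → V G) ] ((∀ i → e (x i) ≡ true) × ⋀ (BA G) n (λ i → var (x i)) ≈ᴳ ⊥ᵗ)
  hyperedge-meet-vanishes {n} edges e edge with edge-≥2 G e edge
  ... | _ , _ , _ , u∈e , _ with hasAtMost⇒imageOfFin e u∈e (edges e edge)
  ...   | x , x∈e , onto = x , x∈e , vanishes
    where
    vanishes : ∀ S → eval G (⋀ (BA G) n (λ i → var (x i))) S ≡ false
    vanishes S with eval G (⋀ (BA G) n (λ i → var (x i))) S in all-true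
    ... | false = refl
    ... | true  = ⊥-elim (proj₂ S e edge e⊆S)
      where
      e⊆S : e ⊆ proj₁ S
      e⊆S v v∈e with onto v v∈e
      ... | i , refl = eval-⋀-true n (λ i → var (x i)) S all-true i

  homomorphism-unique : ∀ {o ℓ} (B : BooleanAlgebra o ℓ) (g : V G → BooleanAlgebra.Carrier B)
    (h : Term (V G) → BooleanAlgebra.Carrier B) → IsHomomorphism (BA G) B h →
    (∀ v → BooleanAlgebra._≈_ B (h (var v)) (g v)) →
    ∀ t → BooleanAlgebra._≈_ B (h t) (interpret B g t)
  homomorphism-unique B g h hom h≈g = go
    where
    open BooleanAlgebra B
    open IsHomomorphism hom
    go : ∀ t → h t ≈ interpret B g t
    go (var v)  = h≈g v
    go (t ∨ᵗ s) = trans (h-∨ t s) (∨-cong (go t) (go s))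
    go (t ∧ᵗ s) = trans (h-∧ t s) (∧-cong (go t) (go s))
    go (¬ᵗ t)   = trans (h-¬ t) (¬-cong (go t))
    go ⊤ᵗ       = h-⊤
    go ⊥ᵗ       = h-⊥

module Extension (lem : ∀ (P : Set) → Dec P) {n : ℕ} (G : Hypergraph) (edges : EdgesAtMost n G)
                 {o ℓ : Level} (B : BooleanAlgebra o ℓ) (f : FunctionOn (BA G) B (V₊ G))
                 (f-preserving : NPreserving (BA G) B (V₊ G) n f) where
  open BooleanAlgebra B using (Carrier; _≈_; ⊥; trans) renaming (refl to ≈-refl)
  open BooleanAlgebra (BA G) using () renaming (_≈_ to _≈ᴳ_)
  open BooleanOrder B
  open ≡.≡-Reasoning

  generator : V G → Σ (Term (V G)) (V₊ G)
  generator v = var v , v , λ S → refl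

  g : V G → Carrier
  g v = fun f (generator v)

  open Literals B g

  positives : List (V G × Bool) → Subset (V G)
  positives L v = does (lem ((v , true) ∈ L))

  positives-sound : ∀ L {v} → positives L v ≡ true → (v , true) ∈ L
  positives-sound L {v} positive with lem ((v , true) ∈ L)
  ... | yes v∈L = v∈L

  below-hyperedge-⊥ : ∀ {c} e → E G e → (∀ v → e v ≡ true → c ⊑ g v) → c ≈ ⊥
  below-hyperedge-⊥ e edge c⊑e with hyperedge-meet-vanishes G edges e edge
  ... | x , x∈e , meet≈⊥ =
    x⊑⊥⇒x≈⊥ (≲-respʳ-≈ (f-preserving (λ i → generator (x i)) meet≈⊥)
                        (⊑-⋀ n (λ i → g (x i)) (λ i → c⊑e (x i) (x∈e i))))

  realise : ∀ L {c} → c ⊑ᴸ L → c ≈ ⊥ ⊎ Σ[ σ ∈ Subset (V G) ] (IsAnticlique G σ × σ ⊨ L)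
  realise L {c} c⊑L with lem (Σ[ v ∈ V G ] ((v , true) ∈ L × (v , false) ∈ L))
  ... | yes (v , pos , neg) = inj₁ (⊑-contradiction (c⊑L pos) (c⊑L neg))
  ... | no consistent with lem (Σ[ e ∈ Subset (V G) ] (E G e × e ⊆ positives L))
  ...   | yes (e , edge , e⊆L) =
    inj₁ (below-hyperedge-⊥ e edge (λ v v∈e → c⊑L (positives-sound L (e⊆L v v∈e))))
  realise L {c} c⊑L | no consistent | no independent =
    inj₂ (positives L , (λ e edge e⊆L → independent (e , edge , e⊆L)) , positives⊨L)
    where
    positives⊨L : positives L ⊨ L
    positives⊨L {v} {b} vb∈L with lem ((v , true) ∈ L) | b
    ... | yes _   | true  = refl
    ... | yes pos | false = ⊥-elim (consistent (v , pos , vb∈L))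
    ... | no ¬pos | true  = ⊥-elim (¬pos vb∈L)
    ... | no _    | false = refl

  ⟦_⟧ : Term (V G) → Carrier
  ⟦_⟧ = interpret B g

  ⟦⟧-cong : ∀ t s → t ≈ᴳ s → ⟦ t ⟧ ≈ ⟦ s ⟧
  ⟦⟧-cong t s t≈s = interpret-cong (IsAnticlique G) realise t s λ σ anticlique →
    let S = σ , anticlique in begin
      interpret 𝔹 σ t  ≡⟨ eval≡interpret𝔹 G t S ⟨
      eval G t S       ≡⟨ t≈s S ⟩
      eval G s S       ≡⟨ eval≡interpret𝔹 G s S ⟩
      interpret 𝔹 σ s  ∎

  ⟦⟧-homomorphism : IsHomomorphism (BA G) B ⟦_⟧
  ⟦⟧-homomorphism = record
    { cong-h = λ {t} {s} → ⟦⟧-cong t s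
    ; h-∨    = λ _ _ → ≈-refl
    ; h-∧    = λ _ _ → ≈-refl
    ; h-¬    = λ _ → ≈-refl
    ; h-⊤    = ≈-refl
    ; h-⊥    = ≈-refl
    }

  ⟦⟧-extends : Extends (BA G) B (V₊ G) f ⟦_⟧
  ⟦⟧-extends (t , v , t≈v) =
    trans (⟦⟧-cong t (var v) t≈v) (wd f (generator v) (t , v , t≈v) (λ S → ≡.sym (t≈v S)))

  extendsUniquely : ExtendsUniquely (BA G) B (V₊ G) f
  extendsUniquely = ⟦_⟧ , ⟦⟧-homomorphism , ⟦⟧-extends ,
    λ h hom h-extends → homomorphism-unique G B g h hom (λ v → h-extends (generator v))

isNFreeOverV₊ : (lem : ∀ (P : Set) → Dec P) (n : ℕ) (G : Hypergraph) → EdgesAtMost n G →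
                IsNFreeOver n (BA G) (V₊ G)
isNFreeOverV₊ lem n G edges B _ f f-preserving = Extension.extendsUniquely lem G edges B f f-preserving

mainTheorem4 : (lem : ∀ (P : Set) → Dec P) →
    (n : ℕ) → 1 ≤ n → (G : Hypergraph) → EdgesAtMost n G →
    IsNFree n (BA G) ×ω IsNFreeOver n (BA G) (V₊ G)
mainTheorem4 lem n _ G edges = record { U = V₊ G ; free = free } ,ω free
  where
  free : IsNFreeOver n (BA G) (V₊ G)
  free = isNFreeOverV₊ lem n G edges
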